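{- Let $n\ge 1$ and $s\ge 2$, and let $\mathcal{T}^s_n$ be the set of $n\times n$ tableaux with entries in the ordered alphabet $A=\{\alpha_1<\dots<\alpha_s\}$. The map $\mathrm{Inc}_\preceq\circ\pi_n^n\circ\mathfrak{P}:\mathcal{T}^s_n\to(\mathcal{P}_n)^n$ is constant on each equivalence class of the relation $\sim_{\mathbf c}$. That is, if $T\sim_{\mathbf c}T'$, then $\mathrm{Inc}_\preceq(\pi_n^n(\mathfrak{P}(T)))=\mathrm{Inc}_\preceq(\pi_n^n(\mathfrak{P}(T')))$.
   Context: Compositions are finite sequences $\lambda=\lambda_0\lambda_1\cdots\lambda_{m-1}$ of natural numbers, zeros allowed. The length of $\lambda$ is $\ell(\lambda)=m$ and its weight $|\lambda|$ is the sum of its entries. $\mathcal{C}_n$ denotes the set of compositions of weight $n$. A partition of weight $n$ is a weakly decreasing composition of weight $n$, and $\mathcal{P}_n$ denotes the set of these. The map $\pi_n:\mathcal{C}_n\to\mathcal{P}_n$ rearranges the entries of a composition in weakly decreasing order, and $\pi_n^n=\pi_n\times\dots\times\pi_n$ ($n$ factors) acts coordinatewise on $(\mathcal{C}_n)^n$. The composition order $\preceq$ is the total order defined by $\lambda\preceq\lambda'$ iff $\ell(\lambda)<\ell(\lambda')$, or $\ell(\lambda)=\ell(\lambda')$ and $\lambda'\le\lambda$ in the lexicographic order. The map $\mathrm{Inc}_\preceq:(\mathcal{C}_n)^n\to(\mathcal{C}_n)^n$ reorders the entries of a vector increasingly with respect to $\preceq$. For a word $w\in A^\star$, its Parikh composition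 is $\mathfrak{p}(w)=|w|_{\alpha_1}|w|_{\alpha_2}\cdots|w|_{\alpha_s}$, where $|w|_\alpha$ is the number of occurrences of $\alpha$ in $w$. For $T\in\mathcal{T}^s_n$ with column-words $c_1,\dots,c_n$ (read top to bottom), set $\mathfrak{P}(T)=(\mathfrak{p}(c_1),\dots,\mathfrak{p}(c_n))$. Define $T'\sim_{\mathbf c}T$ iff $T'$ can be obtained from $T$ by a finite sequence of the following operations: permuting the rows, permuting the columns, and replacing all entries of one column by their images under a bijection $A\to A$. -}

module Defs where

open import Data.Nat using (ℕ; zero; suc; _≤ᵇ_; _<ᵇ_; _≡ᵇ_)
open import Data.Bool using (Bool; true; false; if_then_else_; _∧_; _∨_)
open import Data.Fin using (Fin; toℕ)
open import Data.Fin.Permutation using (Permutation′; _⟨$⟩ʳ_)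
open import Data.List using (List; []; _∷_; length; map; filter)
open import Data.List.Base using (allFin) renaming (length to len)
open import Data.Product using (Σ; ∃; _×_)
open import Relation.Binary.PropositionalEquality using (_≡_; _≢_)
open import Relation.Binary.Construct.Closure.ReflexiveTransitive using (Star)

Composition : Set
Composition = List ℕ

insertBy : {A : Set} → (A → A → Bool) → A → List A → List A
insertBy le x [] = x ∷ []
insertBy le x (y ∷ ys) = if le x y then x ∷ y ∷ ys else y ∷ insertBy le x ys

sortBy : {A : Set} → (A → A → Bool) → List A → List A
sortBy le [] = []
sortBy le (x ∷ xs) = insertBy le x (sortBy le xs)

π : Composition → Composition
π = sortBy (λ a b → b ≤ᵇ a)

lexLeq : Composition → Composition → Bool
lexLeq [] _ = true
lexLeq (_ ∷ _) [] = false
lexLeq (a ∷ as) (b ∷ bs) = (a <ᵇ b) ∨ ((a ≡ᵇ b) ∧ lexLeq as bs)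

⪯ᵇ : Composition → Composition → Bool
⪯ᵇ l l' = (len l <ᵇ len l') ∨ ((len l ≡ᵇ len l') ∧ lexLeq l' l)

Inc : List Composition → List Composition
Inc = sortBy ⪯ᵇ

-- n × n tableaux over the alphabet A = Fin s (α₁ < … < α_s), indexed (row, column).
Tableau : ℕ → ℕ → Set
Tableau s n = Fin n → Fin n → Fin s

column : ∀ {s n} → Tableau s n → Fin n → List (Fin s)
column T j = map (λ i → T i j) (allFin _)

count : ∀ {s} → Fin s → List (Fin s) → ℕ
count a [] = 0
count a (x ∷ xs) = if toℕ a ≡ᵇ toℕ x then suc (count a xs) else count a xs

parikh : ∀ {s} → List (Fin s) → Composition
parikh {s} w = map (λ a → count a w) (allFin s)

𝔓 : ∀ {s n} → Tableau s n → List Composition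
𝔓 {s} {n} T = map (λ j → parikh (column T j)) (allFin n)

invariant : ∀ {s n} → Tableau s n → List Composition
invariant T = Inc (map π (𝔓 T))

data Step {s n : ℕ} (T T' : Tableau s n) : Set where
  permRows : (σ : Permutation′ n) → (∀ i j → T' i j ≡ T (σ ⟨$⟩ʳ i) j) → Step T T'
  permCols : (σ : Permutation′ n) → (∀ i j → T' i j ≡ T i (σ ⟨$⟩ʳ j)) → Step T T'
  relabelCol : (j₀ : Fin n) (f : Permutation′ s) →
    (∀ i → T' i j₀ ≡ f ⟨$⟩ʳ T i j₀) →
    (∀ i j → j ≢ j₀ → T' i j ≡ T i j) → Step T T'

_∼c_ : ∀ {s n} → Tableau s n → Tableau s n → Set
T' ∼c T = Star Step T T'

-- Every operation generating ∼c permutes the multiset of column shapes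
-- π (parikh c): permuting rows permutes each column word, which leaves its
-- Parikh vector unchanged; relabelling a column by a bijection of the
-- alphabet permutes the entries of its Parikh vector, which π forgets;
-- permuting columns permutes the list of shapes, which Inc forgets. Both π
-- and Inc are insertion sorts for total orders, and sorting by a total order
-- depends only on the multiset being sorted.
module Submission where

open import Defs
open import Data.Bool using (Bool; true; false; T; if_then_else_)
open import Data.Bool.Properties using (T-∨; T-∧)
open import Data.Fin using (Fin; toℕ)
open import Data.Fin.Properties using (toℕ-injective) renaming (_≟_ to _≟ᶠ_)
open import Data.Fin.Permutation using (Permutation′; _⟨$⟩ʳ_; _⟨$⟩ˡ_; flip)
open import Data.List using (List; []; _∷_; map; allFin)
open import Data.List.Base using () renaming (length to len)
open import Data.List.Membership.Propositional using (_∈_)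
open import Data.List.Membership.Propositional.Properties using (∈-allFin; ∈-map⁺)
open import Data.List.Membership.Propositional.Properties.WithK using (unique∧set⇒bag)
open import Data.List.Properties using (map-cong; map-∘; ≡-dec)
open import Data.List.Relation.Binary.BagAndSetEquality using (∼bag⇒↭)
open import Data.List.Relation.Binary.Equality.Propositional using (≋⇒≡)
open import Data.List.Relation.Binary.Lex.Core using (base; halt; this; next)
open import Data.List.Relation.Binary.Lex.Strict using (Lex-≤; ≤-isTotalOrder)
open import Data.List.Relation.Binary.Permutation.Propositional
  using (_↭_; ↭-reflexive; ↭-sym; ↭-trans; ↭⇒↭ₛ; prep; swap)
  renaming (refl to ↭-refl′; trans to ↭-trans′)
import Data.List.Relation.Binary.Permutation.Propositional.Properties as ↭
open import Data.List.Relation.Binary.Pointwise using (Pointwise-≡⇒≡; ≡⇒Pointwise-≡)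
open import Data.List.Relation.Unary.Sorted.TotalOrder.Properties using (↗↭↗⇒≋)
open import Data.List.Relation.Unary.Unique.Propositional.Properties using (allFin⁺)
  renaming (map⁺ to unique-map⁺)
import Data.List.Sort.InsertionSort.Base as InsertionSort
import Data.List.Sort.InsertionSort.Properties as InsertionSortₚ
open import Data.Nat using (ℕ; suc; _≤_; _<_; _≤ᵇ_; _≡ᵇ_)
import Data.Nat.Properties as ℕ
open import Data.Product using (_,_; proj₂)
open import Data.Product.Relation.Binary.Lex.NonStrict using (×-Lex; ×-isTotalOrder)
open import Data.Sum using (inj₁; inj₂)
import Data.Sum as Sum
open import Data.Unit using (tt)
open import Function.Base using (_∘_; _on_)
import Function.Base as F
open import Function.Bundles using (_⇔_; mk⇔; Equivalence; Inverse; Injection)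
import Function.Properties.Equivalence as ⇔
open import Function.Properties.Inverse using (Inverse⇒Injection)
open import Relation.Binary.Bundles using (DecTotalOrder)
open import Relation.Binary.Core using (Rel)
open import Relation.Binary.Definitions using (DecidableEquality)
open import Relation.Binary.Structures using (IsTotalOrder)
import Relation.Binary.Construct.Flip.EqAndOrd as Flip
import Relation.Binary.Construct.On as On
open import Relation.Binary.Construct.Closure.ReflexiveTransitive using (fold)
open import Relation.Binary.PropositionalEquality
  using (_≡_; refl; sym; trans; cong; cong₂; subst)
import Relation.Binary.PropositionalEquality as ≡
open import Relation.Nullary.Decidable using (T?; does-⇔; yes; no)

open Equivalence using (to; from)

isTotalOrder-⇔ : ∀ {a ℓ₁ ℓ₂ ℓ₃} {A : Set a}
  {_≈_ : Rel A ℓ₁} {_≤_ : Rel A ℓ₂} {_≤′_ : Rel A ℓ₃} →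
  (∀ {x y} → x ≈ y ⇔ x ≡ y) → (∀ {x y} → x ≤ y ⇔ x ≤′ y) →
  IsTotalOrder _≈_ _≤_ → IsTotalOrder _≡_ _≤′_
isTotalOrder-⇔ ≈⇔≡ ≤⇔≤′ O = record
  { isPartialOrder = record
    { isPreorder = record
      { isEquivalence = ≡.isEquivalence
      ; reflexive = λ x≡y → to ≤⇔≤′ (O.reflexive (from ≈⇔≡ x≡y))
      ; trans = λ x≤y y≤z → to ≤⇔≤′ (O.trans (from ≤⇔≤′ x≤y) (from ≤⇔≤′ y≤z))
      }
    ; antisym = λ x≤y y≤x → to ≈⇔≡ (O.antisym (from ≤⇔≤′ x≤y) (from ≤⇔≤′ y≤x))
    }
  ; total = λ x y → Sum.map (to ≤⇔≤′) (to ≤⇔≤′) (O.total x y)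
  }
  where module O = IsTotalOrder O

module _ {A : Set} (le : A → A → Bool) (_≟_ : DecidableEquality A)
         (isTotalOrder : IsTotalOrder _≡_ (λ x y → T (le x y))) where

  private
    order : DecTotalOrder _ _ _
    order = record
      { isDecTotalOrder = record
        { isTotalOrder = isTotalOrder
        ; _≟_ = _≟_
        ; _≤?_ = λ x y → T? (le x y)
        }
      }
    open InsertionSort order using (insert; sort)
    open InsertionSortₚ order using (sort-↭; sort-↗)

    insertBy≡insert : ∀ x ys → insertBy le x ys ≡ insert x ys
    insertBy≡insert x [] = refl
    insertBy≡insert x (y ∷ ys) with le x y
    ... | true = refl
    ... | false = cong (y ∷_) (insertBy≡insert x ys)

    sortBy≡sort : ∀ xs → sortBy le xs ≡ sort xs
    sortBy≡sort [] = refl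
    sortBy≡sort (x ∷ xs) rewrite sortBy≡sort xs = insertBy≡insert x (sort xs)

  sortBy-↭ : ∀ {xs ys} → xs ↭ ys → sortBy le xs ≡ sortBy le ys
  sortBy-↭ {xs} {ys} xs↭ys rewrite sortBy≡sort xs | sortBy≡sort ys =
    ≋⇒≡ (↗↭↗⇒≋ (DecTotalOrder.totalOrder order) (sort-↗ xs) (sort-↗ ys)
      (↭⇒↭ₛ (↭-trans (sort-↭ xs) (↭-trans xs↭ys (↭-sym (sort-↭ ys))))))

≥ᵇ-isTotalOrder : IsTotalOrder _≡_ (λ m n → T (n ≤ᵇ m))
≥ᵇ-isTotalOrder = isTotalOrder-⇔ ⇔.refl (mk⇔ ℕ.≤⇒≤ᵇ (ℕ.≤ᵇ⇒≤ _ _))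
  (Flip.isTotalOrder ℕ.≤-isTotalOrder)

lexLeq⇔Lex-≤ : ∀ {xs ys} → T (lexLeq xs ys) ⇔ Lex-≤ _≡_ _<_ xs ys
lexLeq⇔Lex-≤ = mk⇔ (lexLeq⇒Lex-≤ _ _) Lex-≤⇒lexLeq
  where
  lexLeq⇒Lex-≤ : ∀ xs ys → T (lexLeq xs ys) → Lex-≤ _≡_ _<_ xs ys
  lexLeq⇒Lex-≤ [] [] _ = base tt
  lexLeq⇒Lex-≤ [] (_ ∷ _) _ = halt
  lexLeq⇒Lex-≤ (x ∷ xs) (y ∷ ys) h with to T-∨ h
  ... | inj₁ x<y = this (ℕ.<ᵇ⇒< x y x<y)
  ... | inj₂ h′ with to T-∧ h′
  ... | x≡y , xs≤ys = next (ℕ.≡ᵇ⇒≡ x y x≡y) (lexLeq⇒Lex-≤ xs ys xs≤ys)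
  Lex-≤⇒lexLeq : ∀ {xs ys} → Lex-≤ _≡_ _<_ xs ys → T (lexLeq xs ys)
  Lex-≤⇒lexLeq (base _) = tt
  Lex-≤⇒lexLeq halt = tt
  Lex-≤⇒lexLeq (this x<y) = from T-∨ (inj₁ (ℕ.<⇒<ᵇ x<y))
  Lex-≤⇒lexLeq {x ∷ _} (next refl xs≤ys) =
    from T-∨ (inj₂ (from T-∧ (ℕ.≡⇒≡ᵇ x x refl , Lex-≤⇒lexLeq xs≤ys)))

_⪯_ : Composition → Composition → Set
_⪯_ = ×-Lex _≡_ _≤_ (F.flip (Lex-≤ _≡_ _<_)) on (λ l → len l , l)

⪯ᵇ⇔⪯ : ∀ {l l′} → T (⪯ᵇ l l′) ⇔ l ⪯ l′
⪯ᵇ⇔⪯ {l} {l′} = mk⇔ ⪯ᵇ⇒⪯ ⪯⇒⪯ᵇ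
  where
  ⪯ᵇ⇒⪯ : T (⪯ᵇ l l′) → l ⪯ l′
  ⪯ᵇ⇒⪯ h with to T-∨ h
  ... | inj₁ h′ = let shorter = ℕ.<ᵇ⇒< (len l) (len l′) h′ in
                  inj₁ (ℕ.<⇒≤ shorter , ℕ.<⇒≢ shorter)
  ... | inj₂ h′ with to T-∧ h′
  ... | same , l′≤l = inj₂ (ℕ.≡ᵇ⇒≡ (len l) (len l′) same , to lexLeq⇔Lex-≤ l′≤l)
  ⪯⇒⪯ᵇ : l ⪯ l′ → T (⪯ᵇ l l′)
  ⪯⇒⪯ᵇ (inj₁ (len≤ , len≢)) = from T-∨ (inj₁ (ℕ.<⇒<ᵇ (ℕ.≤∧≢⇒< len≤ len≢)))
  ⪯⇒⪯ᵇ (inj₂ (same , l′≤l)) =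
    from T-∨ (inj₂ (from T-∧ (ℕ.≡⇒≡ᵇ (len l) (len l′) same , from lexLeq⇔Lex-≤ l′≤l)))

⪯ᵇ-isTotalOrder : IsTotalOrder _≡_ (λ l l′ → T (⪯ᵇ l l′))
⪯ᵇ-isTotalOrder = isTotalOrder-⇔
  (mk⇔ (Pointwise-≡⇒≡ ∘ proj₂) (λ l≡l′ → cong len l≡l′ , ≡⇒Pointwise-≡ l≡l′))
  (⇔.sym ⪯ᵇ⇔⪯)
  (On.isTotalOrder _ (×-isTotalOrder ℕ._≟_ ℕ.≤-isTotalOrder
    (Flip.isTotalOrder (≤-isTotalOrder ℕ.<-isStrictTotalOrder))))

π-↭ : ∀ {xs ys} → xs ↭ ys → π xs ≡ π ys
π-↭ = sortBy-↭ _ ℕ._≟_ ≥ᵇ-isTotalOrder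

Inc-↭ : ∀ {xs ys} → xs ↭ ys → Inc xs ≡ Inc ys
Inc-↭ = sortBy-↭ ⪯ᵇ (≡-dec ℕ._≟_) ⪯ᵇ-isTotalOrder

-- Both sides enumerate Fin n without repetition, so they agree as bags.
map-allFin-↭ : ∀ {n} (σ : Permutation′ n) → map (σ ⟨$⟩ʳ_) (allFin n) ↭ allFin n
map-allFin-↭ {n} σ = ∼bag⇒↭ (unique∧set⇒bag
  (unique-map⁺ (Injection.injective (Inverse⇒Injection σ)) (allFin⁺ n)) (allFin⁺ n)
  (λ {i} → mk⇔ (λ _ → ∈-allFin i) (λ _ → subst (_∈ map (σ ⟨$⟩ʳ_) (allFin n))
    (Inverse.strictlyInverseˡ σ i) (∈-map⁺ (σ ⟨$⟩ʳ_) (∈-allFin (σ ⟨$⟩ˡ i))))))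

map-∘-allFin-↭ : ∀ {n} {B : Set} (σ : Permutation′ n) (g : Fin n → B) →
  map (g ∘ (σ ⟨$⟩ʳ_)) (allFin n) ↭ map g (allFin n)
map-∘-allFin-↭ {n} σ g =
  subst (_↭ map g (allFin n)) (sym (map-∘ (allFin n))) (↭.map⁺ g (map-allFin-↭ σ))

-- count a (x ∷ w) unfolds to incIf (toℕ a ≡ᵇ toℕ x) (count a w).
private
  incIf : Bool → ℕ → ℕ
  incIf b c = if b then suc c else c

  incIf-comm : ∀ b b′ c → incIf b (incIf b′ c) ≡ incIf b′ (incIf b c)
  incIf-comm false false c = refl
  incIf-comm false true  c = refl
  incIf-comm true  false c = refl
  incIf-comm true  true  c = refl

count-↭ : ∀ {s} (a : Fin s) {xs ys} → xs ↭ ys → count a xs ≡ count a ys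
count-↭ a ↭-refl′ = refl
count-↭ a (prep x p) = cong (incIf (toℕ a ≡ᵇ toℕ x)) (count-↭ a p)
count-↭ a (swap x y p) =
  trans (cong (incIf a≟x ∘ incIf a≟y) (count-↭ a p)) (incIf-comm a≟x a≟y _)
  where
  a≟x a≟y : Bool
  a≟x = toℕ a ≡ᵇ toℕ x
  a≟y = toℕ a ≡ᵇ toℕ y
count-↭ a (↭-trans′ p q) = trans (count-↭ a p) (count-↭ a q)

toℕ-≡ᵇ-⇔ : ∀ {m n} {a b : Fin m} {c d : Fin n} →
  a ≡ b ⇔ c ≡ d → (toℕ a ≡ᵇ toℕ b) ≡ (toℕ c ≡ᵇ toℕ d)
toℕ-≡ᵇ-⇔ {a = a} {b} {c} {d} a≡b⇔c≡d =
  does-⇔ (⇔.trans toℕ-≡⇔≡ (⇔.trans a≡b⇔c≡d (⇔.sym toℕ-≡⇔≡)))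
         (toℕ a ℕ.≟ toℕ b) (toℕ c ℕ.≟ toℕ d)
  where
  toℕ-≡⇔≡ : ∀ {k} {i j : Fin k} → toℕ i ≡ toℕ j ⇔ i ≡ j
  toℕ-≡⇔≡ = mk⇔ toℕ-injective (cong toℕ)

count-map : ∀ {s} (f : Permutation′ s) a w →
  count a (map (f ⟨$⟩ʳ_) w) ≡ count (f ⟨$⟩ˡ a) w
count-map f a [] = refl
count-map f a (x ∷ w) = cong₂ incIf
  (toℕ-≡ᵇ-⇔ (mk⇔ (Inverse.inverseʳ f) (sym ∘ Inverse.inverseˡ f ∘ sym)))
  (count-map f a w)

parikh-↭ : ∀ {s} {w w′ : List (Fin s)} → w ↭ w′ → parikh w ≡ parikh w′
parikh-↭ {s} w↭w′ = map-cong (λ a → count-↭ a w↭w′) (allFin s)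

parikh-map-↭ : ∀ {s} (f : Permutation′ s) w → parikh (map (f ⟨$⟩ʳ_) w) ↭ parikh w
parikh-map-↭ {s} f w = subst (_↭ parikh w)
  (sym (map-cong (λ a → count-map f a w) (allFin s)))
  (map-∘-allFin-↭ (flip f) (λ a → count a w))

module _ {s n : ℕ} where

  shape : Tableau s n → Fin n → Composition
  shape T j = π (parikh (column T j))

  shapes : Tableau s n → List Composition
  shapes T = map (shape T) (allFin n)

  invariant-↭ : ∀ {T T′} → shapes T ↭ shapes T′ → invariant T ≡ invariant T′
  invariant-↭ {T} {T′} shapes↭ = begin
    Inc (map π (𝔓 T))   ≡⟨ cong Inc (map-∘ (allFin n)) ⟨
    Inc (shapes T)      ≡⟨ Inc-↭ shapes↭ ⟩
    Inc (shapes T′)     ≡⟨ cong Inc (map-∘ (allFin n)) ⟩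
    Inc (map π (𝔓 T′))  ∎
    where open ≡.≡-Reasoning

  step-shapes-↭ : ∀ {T T′} → Step T T′ → shapes T′ ↭ shapes T
  step-shapes-↭ {T} {T′} (permRows σ T′≡) = ↭-reflexive (map-cong shape≡ (allFin n))
    where
    column↭ : ∀ j → column T′ j ↭ column T j
    column↭ j = subst (_↭ column T j) (sym (map-cong (λ i → T′≡ i j) (allFin n)))
      (map-∘-allFin-↭ σ (λ i → T i j))
    shape≡ : ∀ j → shape T′ j ≡ shape T j
    shape≡ j = cong π (parikh-↭ (column↭ j))
  step-shapes-↭ {T} {T′} (permCols σ T′≡) =
    subst (_↭ shapes T) (sym (map-cong shape≡ (allFin n))) (map-∘-allFin-↭ σ (shape T))
    where
    shape≡ : ∀ j → shape T′ j ≡ shape T (σ ⟨$⟩ʳ j)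
    shape≡ j = cong (π ∘ parikh) (map-cong (λ i → T′≡ i j) (allFin n))
  step-shapes-↭ {T} {T′} (relabelCol j₀ f T′≡at T′≡off) =
    ↭-reflexive (map-cong shape≡ (allFin n))
    where
    relabelled : column T′ j₀ ≡ map (f ⟨$⟩ʳ_) (column T j₀)
    relabelled = trans (map-cong T′≡at (allFin n)) (map-∘ (allFin n))
    shape≡ : ∀ j → shape T′ j ≡ shape T j
    shape≡ j with j ≟ᶠ j₀
    ... | no j≢j₀ = cong (π ∘ parikh) (map-cong (λ i → T′≡off i j j≢j₀) (allFin n))
    ... | yes refl = π-↭ (subst (_↭ parikh (column T j)) (cong parikh (sym relabelled))
      (parikh-map-↭ f (column T j)))

step-invariant : ∀ {s n} {T T′ : Tableau s n} → Step T T′ → invariant T ≡ invariant T′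
step-invariant st = invariant-↭ (↭-sym (step-shapes-↭ st))

mainTheorem1 : (n s : ℕ) → 1 ≤ n → 2 ≤ s → (T T' : Tableau s n) →
    T ∼c T' → invariant T ≡ invariant T'
mainTheorem1 n s _ _ T T' T'⇝T =
  sym (fold (_≡_ on invariant) (trans ∘ step-invariant) refl T'⇝T)
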